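{- Let $M=(S,T,I,L,F=\{F_0,\ldots,F_f\})$ be a fair Kripke structure. Then there exist $k$ and $0<l\le k$ such that $M$ has an initialised fair $(k,l)$-loop if and only if there exists $k\in\mathbb{N}$ such that the general Büchi encoding $[\![M,k]\!]$ is satisfiable.
   Context: A fair Kripke structure $M=(S,T,I,L,F)$ has a finite state set $S$ (valuations of finitely many Boolean state variables), total transition relation $T\subseteq S\times S$, initial states $I\subseteq S$, labelling $L$, and acceptance sets $F_0,\dots,F_f\subseteq S$. An infinite path $s_0s_1\ldots$ is initialised if $s_0\in I$, and fair if it contains infinitely many states from each $F_m$. It is a $(k,l)$-loop if it equals $(s_0\ldots s_{l-1})(s_l\ldots s_k)^\omega$ with $0<l\le k$ and $s_{l-1}=s_k$. The general Büchi encoding for bound $k$: take propositional copies $s_0,\dots,s_k$ of the state variables and fresh Boolean variables $l_0..l_k$, $\mathit{InLoop}_0..\mathit{InLoop}_k$, $\mathit{LoopExists}$, and $\langle\!\langle Acc_m\rangle\!\rangle_i$ for $0\le m\le f$, $0\le i\le k$; $[\![M,k]\!]$ is the conjunction of: $I(s_0)\wedge\bigwedge_{i=1}^kT(s_{i-1},s_i)$; $l_0\Leftrightarrow\bot$, $\mathit{InLoop}_0\Leftrightarrow\bot$, and for $1\le i\le k$: $l_i\Rightarrow(s_{i-1}=s_k)$, $\mathit{InLoop}_i\Leftrightarrow\mathit{InLoop}_{i-1}\vee l_i$, $\mathit{InLoop}_{i-1}\Rightarrow\neg l_i$; $\mathit{LoopExists}\Leftrightarrow\mathit{InLoop}_k$;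 $\mathit{LoopExists}\Leftrightarrow\top$; and for each $0\le m\le f$: $\mathit{LoopExists}\Rightarrow\langle\!\langle Acc_m\rangle\!\rangle_k$, $\langle\!\langle Acc_m\rangle\!\rangle_0\Leftrightarrow\bot$, and $\langle\!\langle Acc_m\rangle\!\rangle_i\Leftrightarrow\langle\!\langle Acc_m\rangle\!\rangle_{i-1}\vee(\mathit{InLoop}_i\wedge s_i\in F_m)$ for $1\le i\le k$. -}

module Defs where

open import Data.Bool using (Bool; true; false; _∧_; _∨_; not)
open import Data.Nat using (ℕ; zero; suc; _+_; _∸_; _≤_; _<_; _≥_)
open import Data.Fin using (Fin; inject₁; fromℕ) renaming (zero to fzero; suc to fsuc)
open import Data.Vec using (Vec; lookup)
open import Data.Sum using (_⊎_; inj₁; inj₂)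
open import Data.Product using (Σ; ∃; ∃-syntax; _×_; _,_)
open import Data.List using (List; []; _∷_; foldr; map)
open import Data.List using (allFin)
open import Relation.Binary.PropositionalEquality using (_≡_)

data Formula (V : Set) : Set where
  ⊤ᶠ ⊥ᶠ : Formula V
  var   : V → Formula V
  ¬ᶠ_   : Formula V → Formula V
  _∧ᶠ_ _∨ᶠ_ _⇒ᶠ_ _⇔ᶠ_ : Formula V → Formula V → Formula V

infixr 6 _∧ᶠ_
infixr 5 _∨ᶠ_
infixr 4 _⇒ᶠ_ _⇔ᶠ_

_⇔ᵇ_ : Bool → Bool → Bool
true  ⇔ᵇ b = b
false ⇔ᵇ b = not b

⟦_⟧ : ∀ {V} → Formula V → (V → Bool) → Bool
⟦ ⊤ᶠ ⟧ ρ = true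
⟦ ⊥ᶠ ⟧ ρ = false
⟦ var x ⟧ ρ = ρ x
⟦ ¬ᶠ φ ⟧ ρ = not (⟦ φ ⟧ ρ)
⟦ φ ∧ᶠ ψ ⟧ ρ = ⟦ φ ⟧ ρ ∧ ⟦ ψ ⟧ ρ
⟦ φ ∨ᶠ ψ ⟧ ρ = ⟦ φ ⟧ ρ ∨ ⟦ ψ ⟧ ρ
⟦ φ ⇒ᶠ ψ ⟧ ρ = not (⟦ φ ⟧ ρ) ∨ ⟦ ψ ⟧ ρ
⟦ φ ⇔ᶠ ψ ⟧ ρ = ⟦ φ ⟧ ρ ⇔ᵇ ⟦ ψ ⟧ ρ

rename : ∀ {V W} → (V → W) → Formula V → Formula W
rename r ⊤ᶠ = ⊤ᶠ
rename r ⊥ᶠ = ⊥ᶠ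
rename r (var x) = var (r x)
rename r (¬ᶠ φ) = ¬ᶠ rename r φ
rename r (φ ∧ᶠ ψ) = rename r φ ∧ᶠ rename r ψ
rename r (φ ∨ᶠ ψ) = rename r φ ∨ᶠ rename r ψ
rename r (φ ⇒ᶠ ψ) = rename r φ ⇒ᶠ rename r ψ
rename r (φ ⇔ᶠ ψ) = rename r φ ⇔ᶠ rename r ψ

⋀ : ∀ {V} (n : ℕ) → (Fin n → Formula V) → Formula V
⋀ n φ = foldr _∧ᶠ_ ⊤ᶠ (map φ (allFin n))

Satisfiable : ∀ {V} → Formula V → Set
Satisfiable {V} φ = Σ (V → Bool) λ ρ → ⟦ φ ⟧ ρ ≡ true

State : ℕ → Set
State n = Vec Bool n

record FairKripke (n f : ℕ) (AP : Set) : Set where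
  field
    Init  : Formula (Fin n)
    Trans : Formula (Fin n ⊎ Fin n)      -- T(s, s'): inj₁ = current, inj₂ = next
    Lab   : State n → AP → Bool
    Acc   : Fin (suc f) → Formula (Fin n)

  _∈I : State n → Set
  s ∈I = ⟦ Init ⟧ (lookup s) ≡ true

  T : State n → State n → Set
  T s s' = ⟦ Trans ⟧ (λ { (inj₁ j) → lookup s j ; (inj₂ j) → lookup s' j }) ≡ true

  _∈F_ : State n → Fin (suc f) → Set
  s ∈F m = ⟦ Acc m ⟧ (lookup s) ≡ true

  field
    total : ∀ s → ∃[ s' ] T s s'

module _ {n f : ℕ} {AP : Set} (M : FairKripke n f AP) where
  open FairKripke M

  IsPath : (ℕ → State n) → Set
  IsPath π = ∀ i → T (π i) (π (suc i))

  Initialised : (ℕ → State n) → Set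
  Initialised π = π 0 ∈I

  Fair : (ℕ → State n) → Set
  Fair π = ∀ (m : Fin (suc f)) (N : ℕ) → ∃[ i ] (N ≤ i × π i ∈F m)

  -- π = (s_0 … s_{l-1}) (s_l … s_k)^ω  with  s_{l-1} = s_k
  -- (the loop part has length k + 1 - l, and the path is periodic from l on)
  IsKLLoop : ℕ → ℕ → (ℕ → State n) → Set
  IsKLLoop k l π =
    0 < l × l ≤ k × π (l ∸ 1) ≡ π k ×
    (∀ i → l ≤ i → π (i + (suc k ∸ l)) ≡ π i)

  HasInitFairKLLoop : ℕ → ℕ → Set
  HasInitFairKLLoop k l =
    ∃[ π ] (IsPath π × Initialised π × Fair π × IsKLLoop k l π)

  -- Variables of the general Büchi encoding for bound k
  -- (indices i range over Fin (suc k) = {0..k}, m over Fin (suc f))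

  data EncVar (k : ℕ) : Set where
    sv         : Fin (suc k) → Fin n → EncVar k   -- j-th state variable of s_i
    lv         : Fin (suc k) → EncVar k
    inLoop     : Fin (suc k) → EncVar k
    loopExists : EncVar k
    accv       : Fin (suc f) → Fin (suc k) → EncVar k

  module _ (k : ℕ) where
    private
      F = Formula (EncVar k)
      last : Fin (suc k)
      last = fromℕ k
      -- for i' : Fin k representing i ∈ {1..k}:  prev = i-1, cur = i
      prev cur : Fin k → Fin (suc k)
      prev = inject₁
      cur  = fsuc

    sAt : Fin (suc k) → Fin n → EncVar k
    sAt i j = sv i j

    I⟨_⟩ : Fin (suc k) → F
    I⟨ i ⟩ = rename (sAt i) Init

    T⟨_,_⟩ : Fin (suc k) → Fin (suc k) → F
    T⟨ i , i' ⟩ = rename (λ { (inj₁ j) → sv i j ; (inj₂ j) → sv i' j }) Trans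

    F⟨_,_⟩ : Fin (suc f) → Fin (suc k) → F
    F⟨ m , i ⟩ = rename (sAt i) (Acc m)

    Eq⟨_,_⟩ : Fin (suc k) → Fin (suc k) → F
    Eq⟨ i , i' ⟩ = ⋀ n (λ j → var (sv i j) ⇔ᶠ var (sv i' j))

    encoding : F
    encoding =
         I⟨ fzero ⟩
      ∧ᶠ ⋀ k (λ i → T⟨ prev i , cur i ⟩)
      ∧ᶠ (var (lv fzero) ⇔ᶠ ⊥ᶠ)
      ∧ᶠ (var (inLoop fzero) ⇔ᶠ ⊥ᶠ)
      ∧ᶠ ⋀ k (λ i →
             (var (lv (cur i)) ⇒ᶠ Eq⟨ prev i , last ⟩)
          ∧ᶠ (var (inLoop (cur i)) ⇔ᶠ (var (inLoop (prev i)) ∨ᶠ var (lv (cur i))))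
          ∧ᶠ (var (inLoop (prev i)) ⇒ᶠ ¬ᶠ var (lv (cur i))))
      ∧ᶠ (var loopExists ⇔ᶠ var (inLoop last))
      ∧ᶠ (var loopExists ⇔ᶠ ⊤ᶠ)
      ∧ᶠ ⋀ (suc f) (λ m →
             (var loopExists ⇒ᶠ var (accv m last))
          ∧ᶠ (var (accv m fzero) ⇔ᶠ ⊥ᶠ)
          ∧ᶠ ⋀ k (λ i →
                var (accv m (cur i)) ⇔ᶠ
                  (var (accv m (prev i)) ∨ᶠ (var (inLoop (cur i)) ∧ᶠ F⟨ m , cur i ⟩))))

{-# OPTIONS --safe #-}
module Submission where

-- Both sides amount to a fair lasso: states s₀ … sₖ with s₀ initial, T between
-- consecutive states, s_{l-1} = sₖ for some 0 < l ≤ k, and every Fₘ met among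
-- s_l … sₖ.  A (k,l)-loop restricts to one (fairness gives a visit to Fₘ at some
-- i ≥ l, and periodicity moves it into l … k); a lasso unrolls to a (k,l)-loop by
-- following i ↦ i+1 below k and k ↦ l.  A lasso yields a model of [[M,k]] with
-- l_i ⇔ i = l, InLoop_i ⇔ l ≤ i, and ⟨⟨Acc_m⟩⟩_i saying that some s_j with
-- l ≤ j ≤ i lies in Fₘ.  Conversely, in a model InLoop switches from false at 0
-- to true at k; where it switches, l_l holds, so l is a loop start, and each
-- ⟨⟨Acc_m⟩⟩ switches at a state that lies in Fₘ and, being in the loop, after l.

open import Data.Bool using (Bool; true; false; _∧_; _∨_; not)
open import Data.Bool.Properties using (∨-zeroʳ)
open import Data.Fin using (Fin; toℕ; inject₁; fromℕ) renaming (zero to fzero; suc to fsuc)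
open import Data.Fin.Properties using (toℕ<n; toℕ-inject₁; toℕ-fromℕ)
open import Data.List using (List; []; _∷_; foldr; map; allFin)
open import Data.List.Relation.Unary.All using (All; []; _∷_)
open import Data.List.Relation.Unary.All.Properties using (map⁺; map⁻; tabulate⁺; tabulate⁻)
open import Data.Nat
open import Data.Nat.DivMod using (_%_; _/_; m%n<n; m≡m%n+[m/n]*n)
open import Data.Nat.Properties
open import Data.Product using (∃-syntax; _×_; _,_; proj₂)
open import Data.Sum using (inj₁; inj₂)
open import Data.Vec using (lookup; tabulate)
open import Data.Vec.Properties using (lookup∘tabulate; tabulate∘lookup; tabulate-cong)
open import Function using (_∘_)
open import Function.Bundles using (_⇔_; mk⇔; Equivalence)
open import Function.Properties.Equivalence using () renaming (trans to ⇔-trans)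
open import Relation.Binary using (tri<; tri≈; tri>)
open import Relation.Binary.PropositionalEquality
open import Relation.Nullary using (Dec; yes; no; does; contradiction)
open import Relation.Nullary.Decidable using (dec-true; dec-false)

open import Defs

open Equivalence using (to; from)

private
  variable
    A V W : Set
    a p i j k : ℕ
    x y : Bool

-- Truth of Boolean connectives and of formulas

∧-true⇔ : x ∧ y ≡ true ⇔ (x ≡ true × y ≡ true)
∧-true⇔ {true}  = mk⇔ (refl ,_) proj₂
∧-true⇔ {false} = mk⇔ (λ ()) (λ ())

⇒-true⇔ : not x ∨ y ≡ true ⇔ (x ≡ true → y ≡ true)
⇒-true⇔ {true}  = mk⇔ (λ y≡true _ → y≡true) (λ x⇒y → x⇒y refl)
⇒-true⇔ {false} = mk⇔ (λ _ ()) (λ _ → refl)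

⇔ᵇ-true⇔ : x ⇔ᵇ y ≡ true ⇔ x ≡ y
⇔ᵇ-true⇔ {true}          = mk⇔ sym sym
⇔ᵇ-true⇔ {false} {false} = mk⇔ (λ _ → refl) (λ _ → refl)
⇔ᵇ-true⇔ {false} {true}  = mk⇔ (λ ()) (λ ())

not-true⇔ : not x ≡ true ⇔ x ≡ false
not-true⇔ {true}  = mk⇔ (λ ()) (λ ())
not-true⇔ {false} = mk⇔ (λ _ → refl) (λ _ → refl)

split³ : ∀ {z} → x ∧ y ∧ z ≡ true → x ≡ true × y ≡ true × z ≡ true
split³ {true} {true} z≡true = refl , refl , z≡true

infixr 4 _∧ᵗ_
_∧ᵗ_ : x ≡ true → y ≡ true → x ∧ y ≡ true
x≡true ∧ᵗ y≡true = from ∧-true⇔ (x≡true , y≡true)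

∨-resolve : x ≡ false → x ∨ y ≡ true → y ≡ true
∨-resolve refl x∨y = x∨y

dec-true⁻¹ : (a? : Dec A) → does a? ≡ true → A
dec-true⁻¹ (yes a) _  = a
dec-true⁻¹ (no _)  ()

_⊨_ : (V → Bool) → Formula V → Set
ρ ⊨ φ = ⟦ φ ⟧ ρ ≡ true

⟦⟧-cong : ∀ (φ : Formula V) {ρ σ : V → Bool} → ρ ≗ σ → ⟦ φ ⟧ ρ ≡ ⟦ φ ⟧ σ
⟦⟧-cong ⊤ᶠ       ρ≗σ = refl
⟦⟧-cong ⊥ᶠ       ρ≗σ = refl
⟦⟧-cong (var v)  ρ≗σ = ρ≗σ v
⟦⟧-cong (¬ᶠ φ)   ρ≗σ = cong not (⟦⟧-cong φ ρ≗σ)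
⟦⟧-cong (φ ∧ᶠ ψ) ρ≗σ = cong₂ _∧_ (⟦⟧-cong φ ρ≗σ) (⟦⟧-cong ψ ρ≗σ)
⟦⟧-cong (φ ∨ᶠ ψ) ρ≗σ = cong₂ _∨_ (⟦⟧-cong φ ρ≗σ) (⟦⟧-cong ψ ρ≗σ)
⟦⟧-cong (φ ⇒ᶠ ψ) ρ≗σ = cong₂ (λ a b → not a ∨ b) (⟦⟧-cong φ ρ≗σ) (⟦⟧-cong ψ ρ≗σ)
⟦⟧-cong (φ ⇔ᶠ ψ) ρ≗σ = cong₂ _⇔ᵇ_ (⟦⟧-cong φ ρ≗σ) (⟦⟧-cong ψ ρ≗σ)

⟦rename⟧ : ∀ (r : V → W) (φ : Formula V) (ρ : W → Bool) →
           ⟦ rename r φ ⟧ ρ ≡ ⟦ φ ⟧ (ρ ∘ r)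
⟦rename⟧ r ⊤ᶠ       ρ = refl
⟦rename⟧ r ⊥ᶠ       ρ = refl
⟦rename⟧ r (var v)  ρ = refl
⟦rename⟧ r (¬ᶠ φ)   ρ = cong not (⟦rename⟧ r φ ρ)
⟦rename⟧ r (φ ∧ᶠ ψ) ρ = cong₂ _∧_ (⟦rename⟧ r φ ρ) (⟦rename⟧ r ψ ρ)
⟦rename⟧ r (φ ∨ᶠ ψ) ρ = cong₂ _∨_ (⟦rename⟧ r φ ρ) (⟦rename⟧ r ψ ρ)
⟦rename⟧ r (φ ⇒ᶠ ψ) ρ = cong₂ (λ a b → not a ∨ b) (⟦rename⟧ r φ ρ) (⟦rename⟧ r ψ ρ)
⟦rename⟧ r (φ ⇔ᶠ ψ) ρ = cong₂ _⇔ᵇ_ (⟦rename⟧ r φ ρ) (⟦rename⟧ r ψ ρ)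

⊨-≗ : ∀ (φ : Formula V) {ρ σ : V → Bool} → ρ ≗ σ → ρ ⊨ φ ⇔ σ ⊨ φ
⊨-≗ φ ρ≗σ = mk⇔ (trans (sym (⟦⟧-cong φ ρ≗σ))) (trans (⟦⟧-cong φ ρ≗σ))

⊨-rename : ∀ (r : V → W) (φ : Formula V) {ρ : W → Bool} → ρ ⊨ rename r φ ⇔ (ρ ∘ r) ⊨ φ
⊨-rename r φ {ρ} = mk⇔ (trans (sym (⟦rename⟧ r φ ρ))) (trans (⟦rename⟧ r φ ρ))

⊨-foldr-∧ : ∀ {ρ : V → Bool} (φs : List (Formula V)) →
            ρ ⊨ foldr _∧ᶠ_ ⊤ᶠ φs ⇔ All (ρ ⊨_) φs
⊨-foldr-∧ []       = mk⇔ (λ _ → []) (λ _ → refl)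
⊨-foldr-∧ (φ ∷ φs) = mk⇔
  (λ sat → let ⊨φ , ⊨φs = to ∧-true⇔ sat in ⊨φ ∷ to (⊨-foldr-∧ φs) ⊨φs)
  (λ { (⊨φ ∷ ⊨φs) → ⊨φ ∧ᵗ from (⊨-foldr-∧ φs) ⊨φs })

⊨-⋀ : ∀ {ρ : V → Bool} n (φ : Fin n → Formula V) → ρ ⊨ ⋀ n φ ⇔ (∀ i → ρ ⊨ φ i)
⊨-⋀ n φ = mk⇔
  (λ sat → tabulate⁻ (map⁻ (to (⊨-foldr-∧ (map φ (allFin n))) sat)))
  (λ sat → from (⊨-foldr-∧ _) (map⁺ (tabulate⁺ sat)))

-- Eventually periodic sequences

PeriodicFrom : ℕ → ℕ → (ℕ → A) → Set
PeriodicFrom a p f = ∀ i → a ≤ i → f (i + p) ≡ f i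

module _ {f : ℕ → A} where
  open ≡-Reasoning

  periodic-* : PeriodicFrom a p f → ∀ c → PeriodicFrom a (c * p) f
  periodic-* per zero i a≤i = cong f (+-identityʳ i)
  periodic-* {p = p} per (suc c) i a≤i = begin
    f (i + (p + c * p)) ≡⟨ cong f (sym (+-assoc i p (c * p))) ⟩
    f (i + p + c * p)   ≡⟨ periodic-* per c (i + p) (≤-trans a≤i (m≤m+n i p)) ⟩
    f (i + p)           ≡⟨ per i a≤i ⟩
    f i                 ∎

  periodic-reduce : PeriodicFrom a p f → .{{NonZero p}} → a ≤ i →
                    ∃[ j ] (a ≤ j × j < a + p × f i ≡ f j)
  periodic-reduce {a} {p} {i} per a≤i =
    a + d % p , m≤m+n a (d % p) , +-monoʳ-< a (m%n<n d p) , f[i]≡f[a+d%p]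
    where
    d : ℕ
    d = i ∸ a

    f[i]≡f[a+d%p] : f i ≡ f (a + d % p)
    f[i]≡f[a+d%p] = begin
      f i                         ≡⟨ cong f (sym (m+[n∸m]≡n a≤i)) ⟩
      f (a + d)                   ≡⟨ cong (f ∘ (a +_)) (m≡m%n+[m/n]*n d p) ⟩
      f (a + (d % p + d / p * p)) ≡⟨ cong f (sym (+-assoc a (d % p) _)) ⟩
      f (a + d % p + d / p * p)   ≡⟨ periodic-* per (d / p) _ (m≤m+n a (d % p)) ⟩
      f (a + d % p)               ∎

  periodic-by-recurrence : (g : A → A) → (∀ i → f (suc i) ≡ g (f i)) →
                           f (a + p) ≡ f a → PeriodicFrom a p f
  periodic-by-recurrence g rec base zero z≤n = base
  periodic-by-recurrence {a} {p} g rec base (suc i) a≤1+i with m≤n⇒m<n∨m≡n a≤1+i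
  ... | inj₂ refl      = base
  ... | inj₁ (s≤s a≤i) = begin
    f (suc (i + p)) ≡⟨ rec (i + p) ⟩
    g (f (i + p))   ≡⟨ cong g (periodic-by-recurrence g rec base i a≤i) ⟩
    g (f i)         ≡⟨ rec i ⟨
    f (suc i)       ∎

period-nonZero : a ≤ k → NonZero (suc k ∸ a)
period-nonZero a≤k = >-nonZero (m<n⇒0<n∸m (s≤s a≤k))

-- Boolean sequences

rising-edge : (b : ℕ → Bool) → b 0 ≡ false → b k ≡ true →
              ∃[ j ] (j < k × b j ≡ false × b (suc j) ≡ true)
rising-edge {zero}  b b₀ bₖ with () ← trans (sym b₀) bₖ
rising-edge {suc k} b b₀ b₁₊ₖ with b k in bₖ
... | false = k , ≤-refl , bₖ , b₁₊ₖ
... | true  = let j , j<k , bⱼ , b₁₊ⱼ = rising-edge b b₀ bₖ in j , m<n⇒m<1+n j<k , bⱼ , b₁₊ⱼ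

∨-accumulate : (b c : ℕ → Bool) → (∀ {j} → j < k → b (suc j) ≡ b j ∨ c j) →
               b i ≡ true → i ≤ j → j ≤ k → b j ≡ true
∨-accumulate {j = zero}  b c step bᵢ z≤n _ = bᵢ
∨-accumulate {j = suc j} b c step bᵢ i≤1+j 1+j≤k with m≤n⇒m<n∨m≡n i≤1+j
... | inj₂ refl      = bᵢ
... | inj₁ (s≤s i≤j) =
  trans (step 1+j≤k) (cong (_∨ c j) (∨-accumulate b c step bᵢ i≤j (<⇒≤ 1+j≤k)))

≤?-suc : ∀ l j → does (l ≤? suc j) ≡ does (l ≤? j) ∨ does (suc j ≟ l)
≤?-suc l j with <-cmp l (suc j)
... | tri< l<1+j _ _
  rewrite dec-true (l ≤? suc j) (<⇒≤ l<1+j) | dec-true (l ≤? j) (s≤s⁻¹ l<1+j) = refl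
... | tri≈ _ refl _
  rewrite dec-true (l ≤? l) ≤-refl | dec-false (l ≤? j) 1+n≰n | dec-true (l ≟ l) refl = refl
... | tri> _ l≢1+j 1+j<l
  rewrite dec-false (l ≤? suc j) (<⇒≱ 1+j<l)
        | dec-false (l ≤? j) (<⇒≱ (<-trans (n<1+n j) 1+j<l))
        | dec-false (suc j ≟ l) (l≢1+j ∘ sym) = refl

-- clamp k j is j for j ≤ k and k beyond; it turns the Fin (suc k)-indexed
-- variables of the encoding into ℕ-indexed sequences.
clamp : (k : ℕ) → ℕ → Fin (suc k)
clamp k       zero    = fzero
clamp zero    (suc j) = fzero
clamp (suc k) (suc j) = fsuc (clamp k j)

clamp-last : ∀ k → clamp k k ≡ fromℕ k
clamp-last zero    = refl
clamp-last (suc k) = cong fsuc (clamp-last k)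

clamp-step : (P : Fin (suc k) → Fin (suc k) → Set) → (∀ i → P (inject₁ i) (fsuc i)) →
             j < k → P (clamp k j) (clamp k (suc j))
clamp-step {suc k} {zero}  P P-step _         = P-step fzero
clamp-step {suc k} {suc j} P P-step (s≤s j<k) =
  clamp-step (λ i i′ → P (fsuc i) (fsuc i′)) (P-step ∘ fsuc) j<k

-- Lassos

module LassoPosition {k l : ℕ} (l≤k : l ≤ k) where
  open ≡-Reasoning

  next : ℕ → ℕ
  next j with j <? k
  ... | yes _ = suc j
  ... | no  _ = l

  position : ℕ → ℕ
  position zero    = 0
  position (suc i) = next (position i)

  next-< : j < k → next j ≡ suc j
  next-< {j} j<k with j <? k
  ... | yes _   = refl
  ... | no  j≮k = contradiction j<k j≮k

  next-last : next k ≡ l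
  next-last with k <? k
  ... | yes k<k = contradiction k<k (<-irrefl refl)
  ... | no  _   = refl

  next-≤ : ∀ j → next j ≤ k
  next-≤ j with j <? k
  ... | yes j<k = j<k
  ... | no  _   = l≤k

  position-≤ : ∀ i → position i ≤ k
  position-≤ zero    = z≤n
  position-≤ (suc i) = next-≤ (position i)

  position-id : i ≤ k → position i ≡ i
  position-id {zero}  _   = refl
  position-id {suc i} i<k = trans (cong next (position-id (<⇒≤ i<k))) (next-< i<k)

  position-periodic : PeriodicFrom l (suc k ∸ l) position
  position-periodic = periodic-by-recurrence next (λ _ → refl) (begin
    position (l + (suc k ∸ l)) ≡⟨ cong position (m+[n∸m]≡n (m≤n⇒m≤1+n l≤k)) ⟩
    next (position k)          ≡⟨ cong next (position-id ≤-refl) ⟩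
    next k                     ≡⟨ next-last ⟩
    l                          ≡⟨ position-id l≤k ⟨
    position l                 ∎)

module _ {n f : ℕ} {AP : Set} (M : FairKripke n f AP) where
  open FairKripke M
  open ≡-Reasoning

  record FairLasso (k l : ℕ) (s : ℕ → State n) : Set where
    field
      0<l     : 0 < l
      l≤k     : l ≤ k
      initial : s 0 ∈I
      step    : j < k → T (s j) (s (suc j))
      closes  : s (l ∸ 1) ≡ s k
      fair    : ∀ m → ∃[ j ] (l ≤ j × j ≤ k × s j ∈F m)

  kl-loop⇒fair-lasso : ∀ {k l π} → IsPath M π → Initialised M π → Fair M π →
                       IsKLLoop M k l π → FairLasso k l π
  kl-loop⇒fair-lasso {k} {l} {π} path init fair (0<l , l≤k , closes , periodic) = record
    { 0<l     = 0<l
    ; l≤k     = l≤k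
    ; initial = init
    ; step    = λ {j} _ → path j
    ; closes  = closes
    ; fair    = fair-within-loop
    }
    where
    instance
      period≢0 : NonZero (suc k ∸ l)
      period≢0 = period-nonZero l≤k

    fair-within-loop : ∀ m → ∃[ j ] (l ≤ j × j ≤ k × π j ∈F m)
    fair-within-loop m =
      let i , l≤i , πᵢ∈F = fair m l
          j , l≤j , j<l+p , πᵢ≡πⱼ = periodic-reduce periodic l≤i
      in j , l≤j , s≤s⁻¹ (subst (j <_) (m+[n∸m]≡n (m≤n⇒m≤1+n l≤k)) j<l+p)
           , subst (_∈F m) πᵢ≡πⱼ πᵢ∈F

  fair-lasso⇒kl-loop : ∀ {k l s} → FairLasso k l s → HasInitFairKLLoop M k l
  fair-lasso⇒kl-loop {k} {l} {s} lasso =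
    s ∘ position , path , initial , fair-unrolled , 0<l , l≤k , closes-unrolled , periodic
    where
    open FairLasso lasso
    open LassoPosition l≤k

    instance
      period≢0 : NonZero (suc k ∸ l)
      period≢0 = period-nonZero l≤k

    1+[l∸1]≡l : suc (l ∸ 1) ≡ l
    1+[l∸1]≡l = m+[n∸m]≡n 0<l

    wrap-around : T (s k) (s l)
    wrap-around = subst₂ T closes (cong s 1+[l∸1]≡l) (step (subst (_≤ k) (sym 1+[l∸1]≡l) l≤k))

    step-next : j ≤ k → T (s j) (s (next j))
    step-next j≤k with m≤n⇒m<n∨m≡n j≤k
    ... | inj₁ j<k  = subst (T _ ∘ s) (sym (next-< j<k)) (step j<k)
    ... | inj₂ refl = subst (T _ ∘ s) (sym next-last) wrap-around

    path : IsPath M (s ∘ position)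
    path i = step-next (position-≤ i)

    closes-unrolled : s (position (l ∸ 1)) ≡ s (position k)
    closes-unrolled = begin
      s (position (l ∸ 1)) ≡⟨ cong s (position-id (≤-trans (m∸n≤m l 1) l≤k)) ⟩
      s (l ∸ 1)            ≡⟨ closes ⟩
      s k                  ≡⟨ cong s (position-id ≤-refl) ⟨
      s (position k)       ∎

    periodic : PeriodicFrom l (suc k ∸ l) (s ∘ position)
    periodic i l≤i = cong s (position-periodic i l≤i)

    fair-unrolled : Fair M (s ∘ position)
    fair-unrolled m N =
      let j , l≤j , j≤k , sⱼ∈F = fair m
          p = suc k ∸ l
          position≡j = trans (periodic-* position-periodic N j l≤j) (position-id j≤k)
      in j + N * p , ≤-trans (m≤m*n N p) (m≤n+m (N * p) j)
       , subst (_∈F m) (cong s (sym position≡j)) sⱼ∈F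

  -- The Büchi encoding

  state : (EncVar M k → Bool) → Fin (suc k) → State n
  state ρ i = tabulate (ρ ∘ sv i)

  module _ {k : ℕ} {ρ : EncVar M k → Bool} where

    lookup-state : ∀ i → lookup (state ρ i) ≗ ρ ∘ sv i
    lookup-state i = lookup∘tabulate (ρ ∘ sv i)

    ⟦F⟨⟩⟧ : ∀ m i → ⟦ F⟨_,_⟩ M k m i ⟧ ρ ≡ ⟦ Acc m ⟧ (lookup (state ρ i))
    ⟦F⟨⟩⟧ m i = trans (⟦rename⟧ (sAt M k i) (Acc m) ρ) (⟦⟧-cong (Acc m) (sym ∘ lookup-state i))

    ⊨-sAt : ∀ i (φ : Formula (Fin n)) → ρ ⊨ rename (sAt M k i) φ ⇔ lookup (state ρ i) ⊨ φ
    ⊨-sAt i φ = ⇔-trans (⊨-rename (sAt M k i) φ) (⊨-≗ φ (sym ∘ lookup-state i))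

    ⊨-T⟨⟩ : ∀ i i′ → ρ ⊨ T⟨_,_⟩ M k i i′ ⇔ T (state ρ i) (state ρ i′)
    ⊨-T⟨⟩ i i′ = ⇔-trans (⊨-rename _ Trans) (⊨-≗ Trans λ
      { (inj₁ j) → sym (lookup-state i j)
      ; (inj₂ j) → sym (lookup-state i′ j) })

    ⊨-Eq⟨⟩ : ∀ i i′ → ρ ⊨ Eq⟨_,_⟩ M k i i′ ⇔ state ρ i ≡ state ρ i′
    ⊨-Eq⟨⟩ i i′ = mk⇔
      (λ sat → tabulate-cong (to ⇔ᵇ-true⇔ ∘ to (⊨-⋀ n _) sat))
      (λ sᵢ≡sᵢ′ → from (⊨-⋀ n _) λ j → from ⇔ᵇ-true⇔ (begin
        ρ (sv i j)            ≡⟨ lookup-state i j ⟨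
        lookup (state ρ i) j  ≡⟨ cong (λ s → lookup s j) sᵢ≡sᵢ′ ⟩
        lookup (state ρ i′) j ≡⟨ lookup-state i′ j ⟩
        ρ (sv i′ j)           ∎))

  record EncodingHolds {k : ℕ} (ρ : EncVar M k → Bool) : Set where
    field
      initial         : state ρ fzero ∈I
      steps           : ∀ i → T (state ρ (inject₁ i)) (state ρ (fsuc i))
      l₀              : ρ (lv fzero) ≡ false
      inLoop₀         : ρ (inLoop fzero) ≡ false
      l⇒closes        : ∀ i → ρ (lv (fsuc i)) ≡ true → state ρ (inject₁ i) ≡ state ρ (fromℕ k)
      inLoop-step     : ∀ i → ρ (inLoop (fsuc i)) ≡ ρ (inLoop (inject₁ i)) ∨ ρ (lv (fsuc i))
      inLoop⇒¬l       : ∀ i → ρ (inLoop (inject₁ i)) ≡ true → ρ (lv (fsuc i)) ≡ false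
      loopExists-def  : ρ loopExists ≡ ρ (inLoop (fromℕ k))
      loopExists-true : ρ loopExists ≡ true
      acc-last        : ∀ m → ρ loopExists ≡ true → ρ (accv m (fromℕ k)) ≡ true
      acc₀            : ∀ m → ρ (accv m fzero) ≡ false
      acc-step        : ∀ m i → ρ (accv m (fsuc i)) ≡ ρ (accv m (inject₁ i)) ∨
                          (ρ (inLoop (fsuc i)) ∧ ⟦ Acc m ⟧ (lookup (state ρ (fsuc i))))

  ⊨encoding⇔ : ∀ {k} {ρ : EncVar M k → Bool} → ρ ⊨ encoding M k ⇔ EncodingHolds ρ
  ⊨encoding⇔ {k} {ρ} = mk⇔ holds satisfies
    where
    acc-update : Fin (suc f) → Fin k → Bool → Bool
    acc-update m i b = ρ (accv m (inject₁ i)) ∨ (ρ (inLoop (fsuc i)) ∧ b)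

    holds : ρ ⊨ encoding M k → EncodingHolds ρ
    holds sat =
      let ⊨init , sat₁    = to ∧-true⇔ sat
          ⊨steps , sat₂   = to ∧-true⇔ sat₁
          ⊨l₀ , sat₃      = to ∧-true⇔ sat₂
          ⊨inLoop₀ , sat₄ = to ∧-true⇔ sat₃
          ⊨loop , sat₅    = to ∧-true⇔ sat₄
          ⊨exists , sat₆  = to ∧-true⇔ sat₅
          ⊨true , ⊨acc    = to ∧-true⇔ sat₆
          loop-clause i   = split³ (to (⊨-⋀ k _) ⊨loop i)
          acc-clause m    = split³ (to (⊨-⋀ (suc f) _) ⊨acc m)
      in record
        { initial         = to (⊨-sAt fzero Init) ⊨init
        ; steps           = to (⊨-T⟨⟩ _ _) ∘ to (⊨-⋀ k _) ⊨steps
        ; l₀              = to ⇔ᵇ-true⇔ ⊨l₀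
        ; inLoop₀         = to ⇔ᵇ-true⇔ ⊨inLoop₀
        ; l⇒closes        = λ i → let ⊨closes , _ = loop-clause i in
                              to (⊨-Eq⟨⟩ _ _) ∘ to ⇒-true⇔ ⊨closes
        ; inLoop-step     = λ i → let _ , ⊨step , _ = loop-clause i in to ⇔ᵇ-true⇔ ⊨step
        ; inLoop⇒¬l       = λ i → let _ , _ , ⊨¬l = loop-clause i in
                              to not-true⇔ ∘ to ⇒-true⇔ ⊨¬l
        ; loopExists-def  = to ⇔ᵇ-true⇔ ⊨exists
        ; loopExists-true = to ⇔ᵇ-true⇔ ⊨true
        ; acc-last        = λ m → let ⊨last , _ = acc-clause m in to ⇒-true⇔ ⊨last
        ; acc₀            = λ m → let _ , ⊨acc₀ , _ = acc-clause m in to ⇔ᵇ-true⇔ ⊨acc₀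
        ; acc-step        = λ m i → let _ , _ , ⊨step = acc-clause m in
                              trans (to ⇔ᵇ-true⇔ (to (⊨-⋀ k _) ⊨step i))
                                    (cong (acc-update m i) (⟦F⟨⟩⟧ m (fsuc i)))
        }

    satisfies : EncodingHolds ρ → ρ ⊨ encoding M k
    satisfies h =
      from (⊨-sAt fzero Init) initial ∧ᵗ
      from (⊨-⋀ k _) (from (⊨-T⟨⟩ _ _) ∘ steps) ∧ᵗ
      from ⇔ᵇ-true⇔ l₀ ∧ᵗ
      from ⇔ᵇ-true⇔ inLoop₀ ∧ᵗ
      from (⊨-⋀ k _) (λ i →
        from ⇒-true⇔ (from (⊨-Eq⟨⟩ _ _) ∘ l⇒closes i) ∧ᵗ
        from ⇔ᵇ-true⇔ (inLoop-step i) ∧ᵗ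
        from ⇒-true⇔ (from not-true⇔ ∘ inLoop⇒¬l i)) ∧ᵗ
      from ⇔ᵇ-true⇔ loopExists-def ∧ᵗ
      from ⇔ᵇ-true⇔ loopExists-true ∧ᵗ
      from (⊨-⋀ (suc f) _) (λ m →
        from ⇒-true⇔ (acc-last m) ∧ᵗ
        from ⇔ᵇ-true⇔ (acc₀ m) ∧ᵗ
        from (⊨-⋀ k _) (λ i →
          from ⇔ᵇ-true⇔ (trans (acc-step m i) (cong (acc-update m i) (sym (⟦F⟨⟩⟧ m (fsuc i)))))))
      where
      open EncodingHolds h

  module FromLasso {k l s} (lasso : FairLasso k l s) where
    open FairLasso lasso

    acc : Fin (suc f) → ℕ → Bool
    acc m zero    = false
    acc m (suc j) = acc m j ∨ (does (l ≤? suc j) ∧ ⟦ Acc m ⟧ (lookup (s (suc j))))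

    ρ : EncVar M k → Bool
    ρ (sv i j)   = lookup (s (toℕ i)) j
    ρ (lv i)     = does (toℕ i ≟ l)
    ρ (inLoop i) = does (l ≤? toℕ i)
    ρ loopExists = true
    ρ (accv m i) = acc m (toℕ i)

    state-ρ : ∀ i → state ρ i ≡ s (toℕ i)
    state-ρ i = tabulate∘lookup (s (toℕ i))

    state-inject₁ : ∀ (i : Fin k) → state ρ (inject₁ i) ≡ s (toℕ i)
    state-inject₁ i = trans (state-ρ (inject₁ i)) (cong s (toℕ-inject₁ i))

    l⇒closes : ∀ i → does (suc (toℕ i) ≟ l) ≡ true → state ρ (inject₁ i) ≡ state ρ (fromℕ k)
    l⇒closes i lᵢ with refl ← dec-true⁻¹ (suc (toℕ i) ≟ l) lᵢ = begin
      state ρ (inject₁ i) ≡⟨ state-inject₁ i ⟩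
      s (toℕ i)           ≡⟨ closes ⟩
      s k                 ≡⟨ cong s (toℕ-fromℕ k) ⟨
      s (toℕ (fromℕ k))   ≡⟨ state-ρ (fromℕ k) ⟨
      state ρ (fromℕ k)   ∎

    inLoop-step : ∀ (i : Fin k) →
                  does (l ≤? suc (toℕ i)) ≡ does (l ≤? toℕ (inject₁ i)) ∨ does (suc (toℕ i) ≟ l)
    inLoop-step i rewrite toℕ-inject₁ i = ≤?-suc l (toℕ i)

    inLoop⇒¬l : ∀ (i : Fin k) → does (l ≤? toℕ (inject₁ i)) ≡ true →
                does (suc (toℕ i) ≟ l) ≡ false
    inLoop⇒¬l i inLoopᵢ = dec-false (suc (toℕ i) ≟ l) λ { refl →
      1+n≰n (subst (suc (toℕ i) ≤_) (toℕ-inject₁ i) (dec-true⁻¹ (_ ≤? _) inLoopᵢ)) }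

    acc-hit : ∀ {m j} → l ≤ j → s j ∈F m → acc m j ≡ true
    acc-hit {j = zero}  l≤0   _    = contradiction (≤-trans 0<l l≤0) λ ()
    acc-hit {m} {suc j} l≤1+j sⱼ∈F = begin
      acc m j ∨ (does (l ≤? suc j) ∧ ⟦ Acc m ⟧ (lookup (s (suc j))))
        ≡⟨ cong₂ (λ x y → acc m j ∨ (x ∧ y)) (dec-true (l ≤? suc j) l≤1+j) sⱼ∈F ⟩
      acc m j ∨ true
        ≡⟨ ∨-zeroʳ (acc m j) ⟩
      true
        ∎

    acc-step : ∀ m (i : Fin k) → acc m (suc (toℕ i)) ≡ acc m (toℕ (inject₁ i)) ∨
                 (does (l ≤? suc (toℕ i)) ∧ ⟦ Acc m ⟧ (lookup (state ρ (fsuc i))))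
    acc-step m i rewrite toℕ-inject₁ i | state-ρ (fsuc i) = refl

    acc-last : ∀ m → acc m k ≡ true
    acc-last m = let j , l≤j , j≤k , sⱼ∈F = fair m
                 in ∨-accumulate (acc m) _ (λ _ → refl) (acc-hit l≤j sⱼ∈F) j≤k ≤-refl

    holds : EncodingHolds ρ
    holds = record
      { initial         = subst _∈I (sym (state-ρ fzero)) initial
      ; steps           = λ i → subst₂ T (sym (state-inject₁ i)) (sym (state-ρ (fsuc i)))
                                         (step (toℕ<n i))
      ; l₀              = dec-false (0 ≟ l) (<⇒≢ 0<l)
      ; inLoop₀         = dec-false (l ≤? 0) (<⇒≱ 0<l)
      ; l⇒closes        = l⇒closes
      ; inLoop-step     = inLoop-step
      ; inLoop⇒¬l       = inLoop⇒¬l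
      ; loopExists-def  = sym (dec-true (l ≤? _) (subst (l ≤_) (sym (toℕ-fromℕ k)) l≤k))
      ; loopExists-true = refl
      ; acc-last        = λ m _ → subst (λ j → acc m j ≡ true) (sym (toℕ-fromℕ k)) (acc-last m)
      ; acc₀            = λ _ → refl
      ; acc-step        = acc-step
      }

  -- The loop start is where InLoop switches on.
  module FromModel {k} {ρ : EncVar M k → Bool} (h : EncodingHolds ρ) where
    open EncodingHolds h

    s : ℕ → State n
    s j = state ρ (clamp k j)

    inLoopᵇ lᵇ : ℕ → Bool
    inLoopᵇ j = ρ (inLoop (clamp k j))
    lᵇ j      = ρ (lv (clamp k j))

    accᵇ : Fin (suc f) → ℕ → Bool
    accᵇ m j = ρ (accv m (clamp k j))

    inLoop-stepᵇ : j < k → inLoopᵇ (suc j) ≡ inLoopᵇ j ∨ lᵇ (suc j)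
    inLoop-stepᵇ = clamp-step (λ i i′ → ρ (inLoop i′) ≡ ρ (inLoop i) ∨ ρ (lv i′)) inLoop-step

    inLoop-lastᵇ : inLoopᵇ k ≡ true
    inLoop-lastᵇ = begin
      ρ (inLoop (clamp k k)) ≡⟨ cong (ρ ∘ inLoop) (clamp-last k) ⟩
      ρ (inLoop (fromℕ k))   ≡⟨ loopExists-def ⟨
      ρ loopExists           ≡⟨ loopExists-true ⟩
      true                   ∎

    l⇒closesᵇ : j < k → lᵇ (suc j) ≡ true → s j ≡ s k
    l⇒closesᵇ j<k lⱼ = trans
      (clamp-step (λ i i′ → ρ (lv i′) ≡ true → state ρ i ≡ state ρ (fromℕ k)) l⇒closes j<k lⱼ)
      (cong (state ρ) (sym (clamp-last k)))

    acc-stepᵇ : ∀ m → j < k →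
                accᵇ m (suc j) ≡ accᵇ m j ∨ (inLoopᵇ (suc j) ∧ ⟦ Acc m ⟧ (lookup (s (suc j))))
    acc-stepᵇ m = clamp-step
      (λ i i′ → ρ (accv m i′) ≡ ρ (accv m i) ∨ (ρ (inLoop i′) ∧ ⟦ Acc m ⟧ (lookup (state ρ i′))))
      (acc-step m)

    acc-lastᵇ : ∀ m → accᵇ m k ≡ true
    acc-lastᵇ m = trans (cong (ρ ∘ accv m) (clamp-last k)) (acc-last m loopExists-true)

    fair-lasso : ∃[ l ] FairLasso k l s
    fair-lasso with rising-edge inLoopᵇ inLoop₀ inLoop-lastᵇ
    ... | j , j<k , off , on = suc j , record
      { 0<l     = s≤s z≤n
      ; l≤k     = j<k
      ; initial = initial
      ; step    = clamp-step (λ i i′ → T (state ρ i) (state ρ i′)) steps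
      ; closes  = l⇒closesᵇ j<k (∨-resolve off (trans (sym (inLoop-stepᵇ j<k)) on))
      ; fair    = fair
      }
      where
      inLoop⇒after-edge : inLoopᵇ i ≡ true → j < i
      inLoop⇒after-edge {i} inLoopᵢ with i ≤? j
      ... | yes i≤j with () ← trans (sym off)
                               (∨-accumulate inLoopᵇ (lᵇ ∘ suc) inLoop-stepᵇ inLoopᵢ i≤j (<⇒≤ j<k))
      ... | no  i≰j = ≰⇒> i≰j

      fair : ∀ m → ∃[ i ] (suc j ≤ i × i ≤ k × s i ∈F m)
      fair m =
        let i , i<k , accᵢ , acc₁₊ᵢ = rising-edge (accᵇ m) (acc₀ m) (acc-lastᵇ m)
            inLoop₁₊ᵢ , F₁₊ᵢ = to ∧-true⇔ (∨-resolve accᵢ (trans (sym (acc-stepᵇ m i<k)) acc₁₊ᵢ))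
        in suc i , inLoop⇒after-edge inLoop₁₊ᵢ , i<k , F₁₊ᵢ

  fair-lasso⇒satisfiable : ∀ {k l s} → FairLasso k l s → Satisfiable (encoding M k)
  fair-lasso⇒satisfiable lasso = FromLasso.ρ lasso , from ⊨encoding⇔ (FromLasso.holds lasso)

  satisfiable⇒fair-lasso : ∀ {k} → Satisfiable (encoding M k) → ∃[ l ] ∃[ s ] FairLasso k l s
  satisfiable⇒fair-lasso (ρ , sat) =
    let l , lasso = FromModel.fair-lasso (to ⊨encoding⇔ sat) in l , _ , lasso

theorem3p4 : ∀ {n f : ℕ} {AP : Set} (M : FairKripke n f AP) →
    (∃[ k ] ∃[ l ] (0 < l × l ≤ k × HasInitFairKLLoop M k l))
      ⇔ (∃[ k ] Satisfiable (encoding M k))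
theorem3p4 M = mk⇔
  (λ (k , l , _ , _ , π , path , init , fair , loop) →
     k , fair-lasso⇒satisfiable M (kl-loop⇒fair-lasso M path init fair loop))
  (λ (k , sat) →
     let l , _ , lasso = satisfiable⇒fair-lasso M sat
     in k , l , FairLasso.0<l lasso , FairLasso.l≤k lasso , fair-lasso⇒kl-loop M lasso)
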